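{- Let $G$ be a finite simple graph and let $t\le 0$ be an integer. Then $G$ has a unique maximal D-chain of order $t$.
   Context: For graphs, $H\le G$ means $H$ is a subgraph of $G$, and $H<G$ means $H\le G$ and $H\neq G$. A D-chain of order $t$ (for an integer $t$) of $G$ is a chain $L\colon G_0\ge G_1\ge\cdots\ge G_k$ of nonempty subgraphs of $G$ such that $G_0=G$, each $G_i$ ($1\le i\le k$) is a vertex-induced subgraph of $G_{i-1}$, and for every $0\le i\le k$ every vertex $v$ of $G_i$ has at least $i$ neighbors in $G_j$, where $j=\max\{0,i+t\}$. The number $k$ is the length $|L|$ of the chain. A D-chain $L\colon G_0\ge\cdots\ge G_k$ of order $t$ is maximal if (i) there is no D-chain $L'$ of order $t$ with $|L'|>k$, and (ii) there is no D-chain $L'\colon G'_0\ge G'_1\ge\cdots\ge G'_k$ of order $t$ such that $G_i<G'_i$ for some $1\le i\le k$. -}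

module Defs where

open import Data.Nat using (ℕ; zero; suc; _≤_; _<_)
open import Data.Integer using (ℤ; +_) renaming (∣_∣ to absℤ; _+_ to _+ℤ_; _⊔_ to _⊔ℤ_)
open import Data.Bool using (Bool; true; false)
open import Data.Fin using (Fin)
open import Data.Fin.Subset using (Subset; _∈_; _⊆_; _⊂_; _∩_; ∣_∣; ⊤; Nonempty)
open import Data.Vec using (tabulate)
open import Data.Product using (_×_; Σ; ∃; _,_)
open import Relation.Binary.PropositionalEquality using (_≡_)
open import Relation.Nullary using (¬_)

record Graph (n : ℕ) : Set where
  field
    adj    : Fin n → Fin n → Bool
    sym    : ∀ u v → adj u v ≡ adj v u
    irrefl : ∀ v → adj v v ≡ false

open Graph public

N : ∀ {n} → Graph n → Fin n → Subset n
N G v = tabulate (adj G v)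

degIn : ∀ {n} → Graph n → Subset n → Fin n → ℕ
degIn G S v = ∣ N G v ∩ S ∣

jIdx : ℕ → ℤ → ℕ
jIdx i t = absℤ ((+ 0) ⊔ℤ ((+ i) +ℤ t))

-- A chain G₀ ≥ G₁ ≥ ⋯ ≥ G_k of vertex-induced subgraphs. Since each Gᵢ is a
-- vertex-induced subgraph of G_{i-1}, every Gᵢ is the subgraph of G induced by
-- its vertex set; we represent Gᵢ by its vertex set (sets i), i ≤ length.
-- Values of sets at indices > length are irrelevant.
record Chain (n : ℕ) : Set where
  field
    length : ℕ
    sets   : ℕ → Subset n

open Chain public

IsDChain : ∀ {n} → Graph n → ℤ → Chain n → Set
IsDChain {n} G t L =
  (sets L 0 ≡ ⊤)
  × (∀ i → i ≤ length L → Nonempty (sets L i))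
  × (∀ i → suc i ≤ length L → sets L (suc i) ⊆ sets L i)
  × (∀ i → i ≤ length L → ∀ (v : Fin n) → v ∈ sets L i →
       i ≤ degIn G (sets L (jIdx i t)) v)

IsMaximalDChain : ∀ {n} → Graph n → ℤ → Chain n → Set
IsMaximalDChain G t L =
  IsDChain G t L
  × (¬ Σ _ λ L' → IsDChain G t L' × length L < length L')
  × (¬ Σ _ λ L' → IsDChain G t L' × length L' ≡ length L
          × ∃ λ i → 1 ≤ i × i ≤ length L × sets L i ⊂ sets L' i)

SameChain : ∀ {n} → Chain n → Chain n → Set
SameChain L L' = (length L ≡ length L') × (∀ i → i ≤ length L → sets L i ≡ sets L' i)

-- Since t ≤ 0, the degree condition at level i only refers to a level j ≤ i, so it
-- is preserved when every level of a D-chain is enlarged.  Hence the levelwise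
-- union of all D-chains of the greatest possible length K is again a D-chain of
-- length K; it contains every D-chain of length K, which makes it maximal, and any
-- maximal D-chain has length K and cannot be strictly below it at any level.
-- The union is computable because D-chains of length K are finitely many
-- vectors of vertex sets.
module Submission where

open import Defs
open import Level using (0ℓ)
open import Data.Nat using (ℕ; zero; suc; _≤_; _<_; z≤n; s≤s; _≤?_)
open import Data.Nat.Properties
  using (≤-refl; ≤-trans; <⇒≤; ≤-antisym; ≤-pred; ≮⇒≥; <-irrefl; <-≤-trans; m≤n⇒m<n∨m≡n; allUpTo?)
open import Data.Integer using (ℤ; +_; +≤+) renaming (_≤_ to _≤ℤ_; _+_ to _+ℤ_)
import Data.Integer.Properties as ℤ
open import Data.Product using (Σ; ∃; _×_; _,_; proj₁; proj₂)
open import Data.Sum using (_⊎_; inj₁; inj₂)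
open import Data.Bool.Properties using () renaming (_≟_ to _≟ᵇ_)
open import Data.Fin using (Fin; zero)
open import Data.Fin.Properties using (all?)
open import Data.Fin.Subset using (Subset; inside; _∈_; _⊆_; _⊂_; _∩_; ⊤; Nonempty)
open import Data.Fin.Subset.Properties
  using (_∈?_; nonempty?; _⊆?_; ⊆-antisym; p⊆q⇒∣p∣≤∣q∣; ∣p∣≤n; ∈⊤; x∈p∩q⁺; x∈p∩q⁻; anySubset?)
open import Data.Vec using (Vec; []; _∷_; tabulate)
open import Data.Vec.Properties using (≡-dec; lookup∘tabulate; []=⇒lookup; lookup⇒[]=)
open import Function using (_∘_)
open import Relation.Binary.PropositionalEquality using (_≡_; refl; trans; subst; subst₂) renaming (sym to ≡-sym)
open import Relation.Nullary using (¬_; Dec; yes; no; does)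
open import Relation.Nullary.Decidable using (_×-dec_; _→-dec_; map′; dec-true)
open import Relation.Unary using (Pred; Decidable)
open import Data.Empty using (⊥-elim)
open import Data.Unit using (tt) renaming (⊤ to Unit)

jIdx≤ : ∀ i {t} → t ≤ℤ + 0 → jIdx i t ≤ i
jIdx≤ i {t} t≤0 = ℤ.drop‿+≤+ (subst (_≤ℤ + i) (≡-sym (ℤ.0≤i⇒+∣i∣≡i (ℤ.i≤i⊔j (+ 0) (+ i +ℤ t))))
                                     (ℤ.⊔-lub (+≤+ z≤n) i+t≤i))
  where
  i+t≤i : + i +ℤ t ≤ℤ + i
  i+t≤i = ℤ.≤-trans (ℤ.+-monoʳ-≤ (+ i) t≤0) (ℤ.≤-reflexive (ℤ.+-identityʳ (+ i)))

∀≤? : {P : Pred ℕ 0ℓ} → Decidable P → ∀ k → Dec (∀ i → i ≤ k → P i)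
∀≤? P? k = map′ (λ f i i≤k → f (s≤s i≤k)) (λ f {i} i<1+k → f i (≤-pred i<1+k)) (allUpTo? P? (suc k))

∀<? : {P : Pred ℕ 0ℓ} → Decidable P → ∀ k → Dec (∀ i → i < k → P i)
∀<? P? k = map′ (λ f i → f {i}) (λ f {i} → f i) (allUpTo? P? k)

Searchable : Set → Set₁
Searchable A = {P : Pred A 0ℓ} → Decidable P → Dec (∃ P)

searchable-Vec : ∀ {A} → Searchable A → ∀ k → Searchable (Vec A k)
searchable-Vec search zero P? = map′ ([] ,_) (λ { ([] , p) → p }) (P? [])
searchable-Vec search (suc k) P? =
  map′ (λ { (x , u , p) → x ∷ u , p }) (λ { (x ∷ u , p) → x , u , p })
       (search λ x → searchable-Vec search k (P? ∘ (x ∷_)))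

subsetOf : ∀ {n} {P : Pred (Fin n) 0ℓ} → Decidable P → Subset n
subsetOf P? = tabulate (does ∘ P?)

module _ {n} {P : Pred (Fin n) 0ℓ} (P? : Decidable P) where

  ∈subsetOf⁺ : ∀ {x} → P x → x ∈ subsetOf P?
  ∈subsetOf⁺ {x} p = lookup⇒[]= x _ (trans (lookup∘tabulate (does ∘ P?) x) (dec-true (P? x) p))

  ∈subsetOf⁻ : ∀ {x} → x ∈ subsetOf P? → P x
  ∈subsetOf⁻ {x} x∈ = witness (P? x) (trans (≡-sym (lookup∘tabulate (does ∘ P?) x)) ([]=⇒lookup x∈))
    where
    witness : (d : Dec (P x)) → does d ≡ inside → P x
    witness (yes p) _ = p
    witness (no _) ()

greatest : {P : Pred ℕ 0ℓ} → Decidable P → ∀ b → P 0 → (∀ k → P k → k ≤ b) →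
           ∃ λ K → P K × (∀ k → P k → k ≤ K)
greatest P? zero P0 bounded = 0 , P0 , bounded
greatest {P} P? (suc b) P0 bounded with P? (suc b)
... | yes P[1+b] = suc b , P[1+b] , bounded
... | no ¬P[1+b] = greatest P? b P0 λ k Pk → below k Pk (m≤n⇒m<n∨m≡n (bounded k Pk))
  where
  below : ∀ k → P k → k < suc b ⊎ k ≡ suc b → k ≤ b
  below k Pk (inj₁ k<1+b) = ≤-pred k<1+b
  below k Pk (inj₂ refl)  = ⊥-elim (¬P[1+b] Pk)

degIn-mono : ∀ {n} (G : Graph n) {S T} v → S ⊆ T → degIn G S v ≤ degIn G T v
degIn-mono G {S} v S⊆T = p⊆q⇒∣p∣≤∣q∣ λ x∈ →
  let x∈N , x∈S = x∈p∩q⁻ (N G v) S x∈ in x∈p∩q⁺ (x∈N , S⊆T x∈S)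

-- Levels past the end of the vector read as ⊤.
nth : ∀ {n k} → Vec (Subset n) k → ℕ → Subset n
nth []       _       = ⊤
nth (S ∷ Ss) zero    = S
nth (S ∷ Ss) (suc i) = nth Ss i

prefix : ∀ {n} → (ℕ → Subset n) → (k : ℕ) → Vec (Subset n) k
prefix f zero    = []
prefix f (suc k) = f 0 ∷ prefix (f ∘ suc) k

nth-prefix : ∀ {n} (f : ℕ → Subset n) {k i} → i < k → nth (prefix f k) i ≡ f i
nth-prefix f {suc k} {zero}  _           = refl
nth-prefix f {suc k} {suc i} (s≤s i<k) = nth-prefix (f ∘ suc) i<k

chainOf : ∀ {n} k → Vec (Subset n) (suc k) → Chain n
chainOf k Ss = record { length = k ; sets = nth Ss }

SameChain-prefix : ∀ {n} (L : Chain n) →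
                   SameChain L (chainOf (length L) (prefix (sets L) (suc (length L))))
SameChain-prefix L = refl , λ i i≤k → ≡-sym (nth-prefix (sets L) (s≤s i≤k))

module _ {n} (G : Graph n) (t : ℤ) where

  IsDChain? : Decidable (IsDChain G t)
  IsDChain? L = ≡-dec _≟ᵇ_ (sets L 0) ⊤
    ×-dec ∀≤? (nonempty? ∘ sets L) (length L)
    ×-dec ∀<? (λ i → sets L (suc i) ⊆? sets L i) (length L)
    ×-dec ∀≤? (λ i → all? λ v → v ∈? sets L i →-dec i ≤? degIn G (sets L (jIdx i t)) v) (length L)

  length≤n : ∀ {L} → IsDChain G t L → length L ≤ n
  length≤n {L} (_ , nonempty , _ , deg) with nonempty (length L) ≤-refl
  ... | v , v∈ = ≤-trans (deg (length L) ≤-refl v v∈) (∣p∣≤n (N G v ∩ sets L (jIdx (length L) t)))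

  ∃DChain : ℕ → Pred (ℕ → Subset n) 0ℓ → Set
  ∃DChain k Q = ∃ λ L → IsDChain G t L × length L ≡ k × Q (sets L)

  HasDChainOfLength : Pred ℕ 0ℓ
  HasDChainOfLength k = ∃DChain k (λ _ → Unit)

module _ {n} (G : Graph n) {t} (t≤0 : t ≤ℤ + 0) where

  IsDChain-resp : ∀ {L L'} → SameChain L L' → IsDChain G t L → IsDChain G t L'
  IsDChain-resp (refl , same) (top , nonempty , nested , deg) =
      trans (≡-sym (same 0 z≤n)) top
    , (λ i i≤k → subst Nonempty (same i i≤k) (nonempty i i≤k))
    , (λ i i<k → subst₂ _⊆_ (same (suc i) i<k) (same i (<⇒≤ i<k)) (nested i i<k))
    , λ i i≤k v → subst₂ (λ S T → v ∈ S → i ≤ degIn G T v)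
                         (same i i≤k) (same (jIdx i t) (≤-trans (jIdx≤ i t≤0) i≤k)) (deg i i≤k v)

  ∃DChain? : ∀ k {Q} → (∀ {f g} → (∀ i → i ≤ k → f i ≡ g i) → Q f → Q g) → Decidable Q →
             Dec (∃DChain G t k Q)
  ∃DChain? k {Q} Q-resp Q? = map′ fromVec toVec
    (searchable-Vec anySubset? (suc k) λ Ss → IsDChain? G t (chainOf k Ss) ×-dec Q? (nth Ss))
    where
    fromVec : (∃ λ Ss → IsDChain G t (chainOf k Ss) × Q (nth Ss)) → ∃DChain G t k Q
    fromVec (Ss , d , q) = chainOf k Ss , d , refl , q
    toVec : ∃DChain G t k Q → ∃ λ Ss → IsDChain G t (chainOf k Ss) × Q (nth Ss)
    toVec (L , d , refl , q) = prefix (sets L) (suc k) , IsDChain-resp (SameChain-prefix L) d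
                             , Q-resp (proj₂ (SameChain-prefix L)) q

  module Union (k : ℕ) where

    -- The bound i ≤ k keeps the junk levels of chains out of the union.
    Covers : ℕ → Pred (Fin n) 0ℓ
    Covers i x = i ≤ k × ∃DChain G t k (λ f → x ∈ f i)

    Covers? : ∀ i → Decidable (Covers i)
    Covers? i x with i ≤? k
    ... | no i≰k  = no (i≰k ∘ proj₁)
    ... | yes i≤k = map′ (i≤k ,_) proj₂
                         (∃DChain? k (λ f≗g → subst (x ∈_) (f≗g i i≤k)) (λ f → x ∈? f i))

    ⋃ : ℕ → Subset n
    ⋃ i = subsetOf (Covers? i)

    unionChain : Chain n
    unionChain = record { length = k ; sets = ⋃ }

    ⊆-unionChain : ∀ {L} → IsDChain G t L → length L ≡ k → ∀ i → i ≤ k → sets L i ⊆ ⋃ i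
    ⊆-unionChain d eq i i≤k x∈ = ∈subsetOf⁺ (Covers? i) (i≤k , _ , d , eq , x∈)

    unionChain-IsDChain : ∀ {L} → IsDChain G t L → length L ≡ k → IsDChain G t unionChain
    unionChain-IsDChain d@(top , nonempty , _ , _) refl =
        ⊆-antisym (λ _ → ∈⊤) (λ _ → ⊆-unionChain d refl 0 z≤n (subst (_ ∈_) (≡-sym top) ∈⊤))
      , (λ i i≤k → let v , v∈ = nonempty i i≤k in v , ⊆-unionChain d refl i i≤k v∈)
      , (λ i i<k x∈ → nested-⋃ i i<k (∈subsetOf⁻ (Covers? (suc i)) x∈))
      , λ i i≤k v v∈ → deg-⋃ i v (∈subsetOf⁻ (Covers? i) v∈)
      where
      nested-⋃ : ∀ i → i < k → ∀ {x} → Covers (suc i) x → x ∈ ⋃ i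
      nested-⋃ i i<k (_ , L , d@(_ , _ , nested , _) , refl , x∈) =
        ⊆-unionChain d refl i (<⇒≤ i<k) (nested i i<k x∈)
      deg-⋃ : ∀ i v → Covers i v → i ≤ degIn G (⋃ (jIdx i t)) v
      deg-⋃ i v (i≤k , L , d@(_ , _ , _ , deg) , refl , v∈) =
        ≤-trans (deg i i≤k v v∈)
                (degIn-mono G v (⊆-unionChain d refl (jIdx i t) (≤-trans (jIdx≤ i t≤0) i≤k)))

  module Longest {K} (hasK : HasDChainOfLength G t K)
                 (K-greatest : ∀ k → HasDChainOfLength G t k → k ≤ K) where
    open Union K

    unionChain-maximal : IsMaximalDChain G t unionChain
    unionChain-maximal = dchain , no-longer , no-larger
      where
      dchain : IsDChain G t unionChain
      dchain = let _ , d , eq , _ = hasK in unionChain-IsDChain d eq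
      no-longer : ¬ Σ _ λ L → IsDChain G t L × K < length L
      no-longer (L , d , K<L) = <-irrefl refl (<-≤-trans K<L (K-greatest _ (L , d , refl , tt)))
      no-larger : ¬ Σ _ λ L → IsDChain G t L × length L ≡ K
                                × ∃ λ i → 1 ≤ i × i ≤ K × ⋃ i ⊂ sets L i
      no-larger (L , d , eq , i , _ , i≤K , _ , x , x∈L , x∉⋃) = x∉⋃ (⊆-unionChain d eq i i≤K x∈L)

    maximal-unique : ∀ {L} → IsMaximalDChain G t L → SameChain unionChain L
    maximal-unique {L} (d@(top , _) , no-longer , no-larger) =
      ≡-sym L≡K , λ i i≤K → ⊆-antisym (⋃⊆ i i≤K) (⊆-unionChain d L≡K i i≤K)
      where
      L≡K : length L ≡ K
      L≡K = ≤-antisym (K-greatest _ (L , d , refl , tt))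
                      (≮⇒≥ λ L<K → no-longer (unionChain , proj₁ unionChain-maximal , L<K))
      ⋃⊆ : ∀ i → i ≤ K → ⋃ i ⊆ sets L i
      ⋃⊆ zero    _     _ = subst (_ ∈_) (≡-sym top) ∈⊤
      ⋃⊆ (suc i) 1+i≤K {x} x∈ with x ∈? sets L (suc i)
      ... | yes x∈L = x∈L
      ... | no  x∉L = ⊥-elim (no-larger (unionChain , proj₁ unionChain-maximal , ≡-sym L≡K
                        , suc i , s≤s z≤n , subst (suc i ≤_) (≡-sym L≡K) 1+i≤K
                        , ⊆-unionChain d L≡K (suc i) 1+i≤K , x , x∈ , x∉L))

trivialChain : ∀ {n} → Chain n
trivialChain = record { length = 0 ; sets = λ _ → ⊤ }

trivialChain-IsDChain : ∀ {m} (G : Graph (suc m)) t → IsDChain G t trivialChain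
trivialChain-IsDChain G t = refl , (λ { zero z≤n → zero , ∈⊤ }) , (λ _ ()) , λ { zero z≤n _ _ → z≤n }

longest : ∀ {m} (G : Graph (suc m)) {t} → t ≤ℤ + 0 →
          ∃ λ K → HasDChainOfLength G t K × (∀ k → HasDChainOfLength G t k → k ≤ K)
longest {m} G {t} t≤0 = greatest (λ k → ∃DChain? G t≤0 k (λ _ _ → tt) (λ _ → yes tt)) (suc m)
  (trivialChain , trivialChain-IsDChain G t , refl , tt) (λ { k (_ , d , refl , _) → length≤n G t d })

propositionC1 : (m : ℕ) (G : Graph (suc m)) (t : ℤ) → t ≤ℤ (+ 0) →
    Σ (Chain (suc m)) λ L → IsMaximalDChain G t L
      × ((L' : Chain (suc m)) → IsMaximalDChain G t L' → SameChain L L')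
propositionC1 m G t t≤0 =
  let K , hasK , K-greatest = longest G t≤0
      open Union G t≤0 K
      open Longest G t≤0 hasK K-greatest
  in unionChain , unionChain-maximal , λ _ → maximal-unique
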